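{- Let $n\ge 6$ be even and let $C_1$ be the $(n-1)\times(n-1)$ matrix defined in the context. Let $X$ be the $(n-1)\times(n-1)$ matrix given by $Xe^1=e^1$, $Xe^2=e^2$; for odd $k$ with $3\le k\le n-3$, $Xe^k=-F_{k-2}e^1+\sum_{i=2}^{k-1}(-1)^{i+1}F_{k-i}e^i+e^k$; for even $k$ with $4\le k\le n-2$, $Xe^k=F_{k-2}e^1+\sum_{i=2}^{k-1}(-1)^{i}F_{k-i}e^i+e^k$; and $Xe^{n-1}=F_{n-4}e^1+\sum_{i=2}^{n-3}(-1)^iF_{n-2-i}e^i+e^{n-1}$. Then $X=C_1^{ -1}$.
   Context: $F_m$ is the $m$-th Fibonacci number, $F_1=F_2=1$, $F_{m+1}=F_m+F_{m-1}$. $e^1,\dots,e^{n-1}$ are the standard basis vectors of $\mathbb{R}^{n-1}$. $C_1$ is the $(n-1)\times(n-1)$ matrix with $C_1e^1=e^1$, $C_1e^2=e^2$; for odd $k$ with $3\le k\le n-3$, $C_1e^k=e^1+\sum_{i=1}^{(k-1)/2}e^{2i}+e^k$; for even $k$ with $4\le k\le n-2$, $C_1e^k=\sum_{i=1}^{(k-2)/2}e^{2i+1}+e^k$; and $C_1e^{n-1}=\sum_{i=1}^{(n-4)/2}e^{2i+1}+e^{n-1}$. -}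

module Defs where

open import Data.Nat as ℕ using (ℕ; zero; suc; _∸_; _≡ᵇ_; _<ᵇ_)
open import Data.Bool using (Bool; true; false; if_then_else_; _∧_; _∨_; not)
open import Data.Integer as ℤ using (ℤ; +_; -_)
open import Data.Fin using (Fin; toℕ)
open import Relation.Binary.PropositionalEquality using (_≡_)
open import Data.Product using (_×_)

F : ℕ → ℕ
F zero = 0
F (suc zero) = 1
F (suc (suc m)) = F (suc m) ℕ.+ F m

_≤ᵇ'_ : ℕ → ℕ → Bool
a ≤ᵇ' b = a <ᵇ suc b

isOdd : ℕ → Bool
isOdd zero = false
isOdd (suc m) = not (isOdd m)

isEven : ℕ → Bool
isEven m = not (isOdd m)

sgn : ℕ → ℤ
sgn i = if isEven i then + 1 else - (+ 1)

δ : ℕ → ℕ → ℤ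
δ i k = if i ≡ᵇ k then + 1 else + 0

bool→ℤ : Bool → ℤ
bool→ℤ b = if b then + 1 else + 0

-- Entries with 1-based indices: (row i, column k) entry, i.e. the
-- e^i-coefficient of M e^k, for the (n-1)x(n-1) matrices.
C1-entry : ℕ → ℕ → ℕ → ℤ
C1-entry n i k =
  if (k ≡ᵇ 1) ∨ (k ≡ᵇ 2) then δ i k
  else if (k ≡ᵇ (n ∸ 1)) then
    bool→ℤ ((isOdd i ∧ (3 ≤ᵇ' i) ∧ (i ≤ᵇ' (n ∸ 3))) ∨ (i ≡ᵇ k))
  else if isOdd k then   -- 3 ≤ k ≤ n-3, k odd
    bool→ℤ ((i ≡ᵇ 1) ∨ (isEven i ∧ (2 ≤ᵇ' i) ∧ (i ≤ᵇ' (k ∸ 1))) ∨ (i ≡ᵇ k))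
  else                   -- 4 ≤ k ≤ n-2, k even
    bool→ℤ ((isOdd i ∧ (3 ≤ᵇ' i) ∧ (i ≤ᵇ' (k ∸ 1))) ∨ (i ≡ᵇ k))

X-entry : ℕ → ℕ → ℕ → ℤ
X-entry n i k =
  if (k ≡ᵇ 1) ∨ (k ≡ᵇ 2) then δ i k
  else if (k ≡ᵇ (n ∸ 1)) then
    (if i ≡ᵇ 1 then + F (n ∸ 4)
     else if (2 ≤ᵇ' i) ∧ (i ≤ᵇ' (n ∸ 3)) then sgn i ℤ.* + F (n ∸ 2 ∸ i)
     else δ i k)
  else if isOdd k then   -- 3 ≤ k ≤ n-3, k odd
    (if i ≡ᵇ 1 then - (+ F (k ∸ 2))
     else if (2 ≤ᵇ' i) ∧ (i ≤ᵇ' (k ∸ 1)) then sgn (suc i) ℤ.* + F (k ∸ i)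
     else δ i k)
  else                   -- 4 ≤ k ≤ n-2, k even
    (if i ≡ᵇ 1 then + F (k ∸ 2)
     else if (2 ≤ᵇ' i) ∧ (i ≤ᵇ' (k ∸ 1)) then sgn i ℤ.* + F (k ∸ i)
     else δ i k)

Matrix : ℕ → Set
Matrix m = Fin m → Fin m → ℤ

C₁ : (n : ℕ) → Matrix (n ∸ 1)
C₁ n i k = C1-entry n (suc (toℕ i)) (suc (toℕ k))

X : (n : ℕ) → Matrix (n ∸ 1)
X n i k = X-entry n (suc (toℕ i)) (suc (toℕ k))

Σ : (m : ℕ) → (Fin m → ℤ) → ℤ
Σ zero f = + 0
Σ (suc m) f = f Fin.zero ℤ.+ Σ m (λ j → f (Fin.suc j))

_⊗_ : {m : ℕ} → Matrix m → Matrix m → Matrix m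
_⊗_ {m} A B i k = Σ m (λ j → A i j ℤ.* B j k)

I : (m : ℕ) → Matrix m
I m i k = δ (toℕ i) (toℕ k)

IsInverseOf : {m : ℕ} → Matrix m → Matrix m → Set
IsInverseOf {m} B A = (∀ i k → (A ⊗ B) i k ≡ I m i k) × (∀ i k → (B ⊗ A) i k ≡ I m i k)

module Submission where

-- Write a_k and b_k for the k-th columns of C₁ and X and e_k for the unit
-- vectors. For the columns 4, …, n−2 both families obey two-step recurrences
--     a_{K+2} = a_K + e_{K+1} + e_{K+2} − e_K,
--     b_{K+2} = e_{K+2} − e_K + b_K − b_{K+1}        (2 ≤ K ≤ n−4),
-- the second being the Fibonacci recurrence F_{m+2} = F_{m+1} + F_m entrywise,
-- while the last columns arise from their neighbours by moving the diagonal 1: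
--     a_{n−1} = a_{n−2} − e_{n−2} + e_{n−1},  b_{n−1} = b_{n−2} − e_{n−2} + e_{n−1}.
-- By linearity, such recurrences propagate the identities C₁ b_k = e_k and
-- X a_k = e_k from earlier columns to later ones; columns 1, 2, 3 are checked
-- directly.

open import Data.Bool using (Bool; true; false; T; not; _∧_; _∨_; if_then_else_)
open import Data.Bool.Properties using (T-≡; T-∧; ¬-not)
open import Data.Fin as Fin using (Fin; toℕ)
open import Data.Fin.Properties using (toℕ<n)
open import Data.Integer using (ℤ; +_; -_; _+_; _-_; _*_; -1ℤ)
open import Data.Integer.Properties using (+-*-semiring; pos-+; +-comm; +-identityˡ; +-identityʳ; *-identityʳ; *-zeroʳ; *-distribˡ-+; neg-distribʳ-*; -1*i≡-i)
open import Data.Integer.Tactic.RingSolver using (solve-∀)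
open import Algebra.Properties.Semiring.Sum +-*-semiring using (sum; sum-cong-≗; ∑-distrib-+; *-distribˡ-sum; sum-replicate-zero)
open import Data.Nat as ℕ using (ℕ; zero; suc; _∸_; _≡ᵇ_; _<ᵇ_; _≤_; _<_; z≤n; s≤s; z<s; s<s)
open import Data.Nat.Divisibility using (_∣_; divides; ∣m∣n⇒∣m+n; ∣m+n∣m⇒∣n)
open import Data.Nat.Properties using (≡⇒≡ᵇ; ≡ᵇ⇒≡; <ᵇ⇒<; <⇒≢; n<1+n; ≤-refl; ≤-trans; n≤1+n; m≤n⇒m≤1+n; m<n⇒m<1+n; m≤n⇒m<n∨m≡n; ≤-pred)
open import Data.Product using (_×_; _,_; proj₁; proj₂)
open import Data.Sum using (inj₁; inj₂)
open import Data.Unit using (tt)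
open import Function using (_∘_)
open import Function.Bundles using (Equivalence)
open import Relation.Binary.PropositionalEquality using (_≡_; _≢_; refl; sym; trans; cong; cong₂; module ≡-Reasoning)

open import Defs

open ≡-Reasoning

≡ᵇ-refl : ∀ a → (a ≡ᵇ a) ≡ true
≡ᵇ-refl a = Equivalence.to T-≡ (≡⇒≡ᵇ a a refl)

≢⇒≡ᵇ-false : ∀ {a b} → a ≢ b → (a ≡ᵇ b) ≡ false
≢⇒≡ᵇ-false {a} {b} a≢b = ¬-not (λ eq → a≢b (≡ᵇ⇒≡ a b (Equivalence.from T-≡ eq)))

<⇒≡ᵇ-false : ∀ {a b} → a < b → (a ≡ᵇ b) ≡ false
<⇒≡ᵇ-false = ≢⇒≡ᵇ-false ∘ <⇒≢

δ-< : ∀ {i k} → i < k → δ i k ≡ + 0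
δ-< i<k = cong (λ b → if b then + 1 else + 0) (<⇒≡ᵇ-false i<k)

Σ≡sum : ∀ m (f : Fin m → ℤ) → Σ m f ≡ sum f
Σ≡sum zero    f = refl
Σ≡sum (suc m) f = cong (λ s → f Fin.zero + s) (Σ≡sum m (f ∘ Fin.suc))

sum-δ : ∀ m (g : ℕ → ℤ) k → k < m → sum {m} (λ j → g (toℕ j) * δ (toℕ j) k) ≡ g k
sum-δ (suc m) g zero _ = begin
  g 0 * + 1 + sum {m} (λ j → g (suc (toℕ j)) * + 0)  ≡⟨ cong₂ _+_ (*-identityʳ (g 0)) zeros ⟩
  g 0 + + 0                                          ≡⟨ +-identityʳ (g 0) ⟩
  g 0                                                ∎
  where
  zeros : sum {m} (λ j → g (suc (toℕ j)) * + 0) ≡ + 0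
  zeros = trans (sum-cong-≗ {m} (λ j → *-zeroʳ (g (suc (toℕ j))))) (sum-replicate-zero m)
sum-δ (suc m) g (suc k) (s≤s k<m) = begin
  g 0 * + 0 + sum {m} (λ j → g (suc (toℕ j)) * δ (toℕ j) k)  ≡⟨ cong₂ _+_ (*-zeroʳ (g 0)) (sum-δ m (g ∘ suc) k k<m) ⟩
  + 0 + g (suc k)                                            ≡⟨ +-identityˡ (g (suc k)) ⟩
  g (suc k)                                                  ∎

-- Vectors are functions ℕ → ℤ indexed from 1, matrices are functions
-- (row, column) ↦ entry; `act m M v i` is the i-th entry of M v, where the
-- sum runs over the columns 1, …, m. It is opaque so that unification
-- compares it by its arguments instead of unfolding the sum.

opaque
  act : ℕ → (ℕ → ℕ → ℤ) → (ℕ → ℤ) → ℕ → ℤ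
  act m M v i = sum {m} (λ j → M i (suc (toℕ j)) * v (suc (toℕ j)))

e : ℕ → ℕ → ℤ
e k i = δ i k

infixl 6 _⊕_ _⊖_

_⊕_ _⊖_ : (ℕ → ℤ) → (ℕ → ℤ) → ℕ → ℤ
(u ⊕ v) j = u j + v j
(u ⊖ v) j = u j - v j

module _ {m : ℕ} {M : ℕ → ℕ → ℤ} {i : ℕ} where

  opaque
    unfolding act

    act-cong : ∀ {u v} → (∀ j → u j ≡ v j) → act m M u i ≡ act m M v i
    act-cong u≗v = sum-cong-≗ {m} (λ j → cong (M i (suc (toℕ j)) *_) (u≗v (suc (toℕ j))))

    act-unit : ∀ k → k < m → act m M (e (suc k)) i ≡ M i (suc k)
    act-unit k k<m = sum-δ m (λ j → M i (suc j)) k k<m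

    act-⊕ : ∀ u v → act m M (u ⊕ v) i ≡ act m M u i + act m M v i
    act-⊕ u v = trans (sum-cong-≗ {m} (λ j → *-distribˡ-+ (M i (suc (toℕ j))) _ _))
                      (∑-distrib-+ {m} _ _)

    act-neg : ∀ v → act m M (λ j → - v j) i ≡ - act m M v i
    act-neg v = begin
      act m M (λ j → - v j) i
        ≡⟨ sum-cong-≗ {m} (λ j → trans (sym (neg-distribʳ-* (M i (suc (toℕ j))) _)) (sym (-1*i≡-i _))) ⟩
      sum {m} (λ j → -1ℤ * (M i (suc (toℕ j)) * v (suc (toℕ j))))
        ≡⟨ sym (*-distribˡ-sum {m} -1ℤ _) ⟩
      -1ℤ * act m M v i
        ≡⟨ -1*i≡-i _ ⟩
      - act m M v i ∎

    act-sum : ∀ v → act m M v i ≡ sum {m} (λ j → M i (suc (toℕ j)) * v (suc (toℕ j)))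
    act-sum v = refl

  infixl 6 _⊕ᵖ_ _⊖ᵖ_

  _⊕ᵖ_ : ∀ {u v α β} → act m M u i ≡ α → act m M v i ≡ β → act m M (u ⊕ v) i ≡ α + β
  _⊕ᵖ_ {u} {v} p q = trans (act-⊕ u v) (cong₂ _+_ p q)

  _⊖ᵖ_ : ∀ {u v α β} → act m M u i ≡ α → act m M v i ≡ β → act m M (u ⊖ v) i ≡ α - β
  _⊖ᵖ_ {u} {v} p q = trans (act-⊕ u (λ j → - v j)) (cong₂ _+_ p (trans (act-neg v) (cong -_ q)))

cancel-shift-A : ∀ a d₀ d₁ d₂ → (a + d₁ + d₂ - d₀) - a + d₀ - d₁ ≡ d₂
cancel-shift-A = solve-∀

cancel-shift-B : ∀ b₀ b₁ d₀ d₂ → d₀ + b₁ + (d₂ - d₀ + b₀ - b₁) - b₀ ≡ d₂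
cancel-shift-B = solve-∀

cancel-last : ∀ d a d′ → d - a + (a - d + d′) ≡ d′
cancel-last = solve-∀

module Propagation (m : ℕ) (A B : ℕ → ℕ → ℤ) where

  a b : ℕ → ℕ → ℤ
  a k i = A i k
  b k i = B i k

  AB BA : ℕ → Set
  AB k = ∀ i → act m A (b k) i ≡ δ i k
  BA k = ∀ i → act m B (a k) i ≡ δ i k

  ShiftA ShiftB : ℕ → Set
  ShiftA K = ∀ i → a (2 ℕ.+ K) i ≡ a K i + δ i (1 ℕ.+ K) + δ i (2 ℕ.+ K) - δ i K
  ShiftB K = ∀ i → b (2 ℕ.+ K) i ≡ δ i (2 ℕ.+ K) - δ i K + b K i - b (1 ℕ.+ K) i

  LastA LastB : ℕ → Set
  LastA K = ∀ i → a (1 ℕ.+ K) i ≡ a K i - δ i K + δ i (1 ℕ.+ K)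
  LastB K = ∀ i → b (1 ℕ.+ K) i ≡ b K i - δ i K + δ i (1 ℕ.+ K)

  AB-shift : ∀ k → 2 ℕ.+ k < m → ShiftA (suc k) → ShiftB (suc k) →
             AB (suc k) → AB (2 ℕ.+ k) → AB (3 ℕ.+ k)
  AB-shift k k+2<m shiftA shiftB ab₁ ab₂ i = begin
    act m A (b (3 ℕ.+ k)) i
      ≡⟨ act-cong shiftB ⟩
    act m A (e (3 ℕ.+ k) ⊖ e (suc k) ⊕ b (suc k) ⊖ b (2 ℕ.+ k)) i
      ≡⟨ act-unit (2 ℕ.+ k) k+2<m ⊖ᵖ act-unit k k<m ⊕ᵖ ab₁ i ⊖ᵖ ab₂ i ⟩
    a (3 ℕ.+ k) i - a (suc k) i + δ i (suc k) - δ i (2 ℕ.+ k)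
      ≡⟨ cong (λ t → t - a (suc k) i + δ i (suc k) - δ i (2 ℕ.+ k)) (shiftA i) ⟩
    (a (suc k) i + δ i (2 ℕ.+ k) + δ i (3 ℕ.+ k) - δ i (suc k)) - a (suc k) i + δ i (suc k) - δ i (2 ℕ.+ k)
      ≡⟨ cancel-shift-A (a (suc k) i) (δ i (suc k)) (δ i (2 ℕ.+ k)) (δ i (3 ℕ.+ k)) ⟩
    δ i (3 ℕ.+ k) ∎
    where
    k<m : k < m
    k<m = ≤-trans (n≤1+n _) (≤-trans (n≤1+n _) k+2<m)

  BA-shift : ∀ k → 2 ℕ.+ k < m → ShiftA (suc k) → ShiftB (suc k) → BA (suc k) → BA (3 ℕ.+ k)
  BA-shift k k+2<m shiftA shiftB ba₁ i = begin
    act m B (a (3 ℕ.+ k)) i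
      ≡⟨ act-cong shiftA ⟩
    act m B (a (suc k) ⊕ e (2 ℕ.+ k) ⊕ e (3 ℕ.+ k) ⊖ e (suc k)) i
      ≡⟨ ba₁ i ⊕ᵖ act-unit (suc k) k+1<m ⊕ᵖ act-unit (2 ℕ.+ k) k+2<m ⊖ᵖ act-unit k k<m ⟩
    δ i (suc k) + b (2 ℕ.+ k) i + b (3 ℕ.+ k) i - b (suc k) i
      ≡⟨ cong (λ t → δ i (suc k) + b (2 ℕ.+ k) i + t - b (suc k) i) (shiftB i) ⟩
    δ i (suc k) + b (2 ℕ.+ k) i + (δ i (3 ℕ.+ k) - δ i (suc k) + b (suc k) i - b (2 ℕ.+ k) i) - b (suc k) i
      ≡⟨ cancel-shift-B (b (suc k) i) (b (2 ℕ.+ k) i) (δ i (suc k)) (δ i (3 ℕ.+ k)) ⟩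
    δ i (3 ℕ.+ k) ∎
    where
    k+1<m : suc k < m
    k+1<m = ≤-trans (n≤1+n _) k+2<m
    k<m : k < m
    k<m = ≤-trans (n≤1+n _) k+1<m

  AB-last : ∀ k → suc k < m → LastA (suc k) → LastB (suc k) → AB (suc k) → AB (2 ℕ.+ k)
  AB-last k k+1<m lastA lastB ab i = begin
    act m A (b (2 ℕ.+ k)) i
      ≡⟨ act-cong lastB ⟩
    act m A (b (suc k) ⊖ e (suc k) ⊕ e (2 ℕ.+ k)) i
      ≡⟨ ab i ⊖ᵖ act-unit k (≤-trans (n≤1+n _) k+1<m) ⊕ᵖ act-unit (suc k) k+1<m ⟩
    δ i (suc k) - a (suc k) i + a (2 ℕ.+ k) i
      ≡⟨ cong (λ t → δ i (suc k) - a (suc k) i + t) (lastA i) ⟩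
    δ i (suc k) - a (suc k) i + (a (suc k) i - δ i (suc k) + δ i (2 ℕ.+ k))
      ≡⟨ cancel-last (δ i (suc k)) (a (suc k) i) (δ i (2 ℕ.+ k)) ⟩
    δ i (2 ℕ.+ k) ∎

  entries : (ℕ → ℕ → ℤ) → Matrix m
  entries M i j = M (suc (toℕ i)) (suc (toℕ j))

  product-identity : (∀ k → k < m → AB (suc k)) → ∀ i k → (entries A ⊗ entries B) i k ≡ I m i k
  product-identity ab i k = trans (Σ≡sum m _) (trans (sym (act-sum _)) (ab (toℕ k) (toℕ<n k) (suc (toℕ i))))

-- Entries of C₁ and X in a column K ∉ {1, 2, n−1}. They depend on the
-- parities of K and of the row i; freezing both parities as Booleans makes
-- the entries invariant under (i, K) ↦ (i+1, K+1), because the tests ≡ᵇ and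
-- <ᵇ are, and this is what makes the recurrences below provable by descent.

sign : Bool → ℤ
sign odd = if not odd then + 1 else - (+ 1)

colC : (kOdd iOdd : Bool) → ℕ → ℕ → ℤ
colC kOdd iOdd i K = if kOdd
  then bool→ℤ ((i ≡ᵇ 1) ∨ (not iOdd ∧ (2 ≤ᵇ' i) ∧ (i ≤ᵇ' (K ∸ 1))) ∨ (i ≡ᵇ K))
  else bool→ℤ ((iOdd ∧ (3 ≤ᵇ' i) ∧ (i ≤ᵇ' (K ∸ 1))) ∨ (i ≡ᵇ K))

colX : (kOdd iOdd : Bool) → ℕ → ℕ → ℤ
colX kOdd iOdd i K = if kOdd
  then (if i ≡ᵇ 1 then - (+ F (K ∸ 2))
        else if (2 ≤ᵇ' i) ∧ (i ≤ᵇ' (K ∸ 1)) then sign (not iOdd) * + F (K ∸ i) else δ i K)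
  else (if i ≡ᵇ 1 then + F (K ∸ 2)
        else if (2 ≤ᵇ' i) ∧ (i ≤ᵇ' (K ∸ 1)) then sign iOdd * + F (K ∸ i) else δ i K)

C-generic : ∀ n i k → (3 ℕ.+ k ≡ᵇ n ∸ 1) ≡ false →
            C1-entry n i (3 ℕ.+ k) ≡ colC (isOdd (3 ℕ.+ k)) (isOdd i) i (3 ℕ.+ k)
C-generic n i k not-last rewrite not-last = refl

X-generic : ∀ n i k → (3 ℕ.+ k ≡ᵇ n ∸ 1) ≡ false →
            X-entry n i (3 ℕ.+ k) ≡ colX (isOdd (3 ℕ.+ k)) (isOdd i) i (3 ℕ.+ k)
X-generic n i k not-last rewrite not-last = refl

-- The two-step recurrences at a single entry (i, K). Column K+2 has the
-- parity `not (not kOdd)` of K, which is what isOdd (2 + K) computes to.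
ShiftC ShiftX : (kOdd iOdd : Bool) → ℕ → ℕ → Set
ShiftC kOdd iOdd i K =
  colC (not (not kOdd)) iOdd i (2 ℕ.+ K) ≡ colC kOdd iOdd i K + δ i (1 ℕ.+ K) + δ i (2 ℕ.+ K) - δ i K
ShiftX kOdd iOdd i K =
  colX (not (not kOdd)) iOdd i (2 ℕ.+ K) ≡ δ i (2 ℕ.+ K) - δ i K + colX kOdd iOdd i K - colX (not kOdd) iOdd i (1 ℕ.+ K)

-- The Fibonacci recurrence F_{k+3} = F_{k+1} + F_{k+2}, read in ℤ, and the
-- three signed forms in which it enters the entries of X (the padding
-- + 0 - + 0 is the value of the two Kronecker deltas off the diagonal).
fib-ℤ : ∀ k → + F (3 ℕ.+ k) ≡ + F (1 ℕ.+ k) + + F (2 ℕ.+ k)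
fib-ℤ k = trans (pos-+ (F (2 ℕ.+ k)) (F (1 ℕ.+ k))) (+-comm (+ F (2 ℕ.+ k)) (+ F (1 ℕ.+ k)))

fib-signed : ∀ s k → s * + F (3 ℕ.+ k) ≡ + 0 - + 0 + s * + F (1 ℕ.+ k) - (- s) * + F (2 ℕ.+ k)
fib-signed s k = trans (cong (s *_) (fib-ℤ k)) (ring s (+ F (1 ℕ.+ k)) (+ F (2 ℕ.+ k)))
  where
  ring : ∀ s x y → s * (x + y) ≡ + 0 - + 0 + s * x - (- s) * y
  ring = solve-∀

fib-negative : ∀ k → - (+ F (3 ℕ.+ k)) ≡ + 0 - + 0 + - (+ F (1 ℕ.+ k)) - + F (2 ℕ.+ k)
fib-negative k = trans (cong -_ (fib-ℤ k)) (ring (+ F (1 ℕ.+ k)) (+ F (2 ℕ.+ k)))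
  where
  ring : ∀ x y → - (x + y) ≡ + 0 - + 0 + - x - y
  ring = solve-∀

fib-positive : ∀ k → + F (3 ℕ.+ k) ≡ + 0 - + 0 + + F (1 ℕ.+ k) - - (+ F (2 ℕ.+ k))
fib-positive k = trans (fib-ℤ k) (ring (+ F (1 ℕ.+ k)) (+ F (2 ℕ.+ k)))
  where
  ring : ∀ x y → x + y ≡ + 0 - + 0 + x - - y
  ring = solve-∀

-- Descent along the diagonal: for rows and columns ≥ 3 the recurrence at
-- (3+j, 3+k) is literally the one at (2+j, 2+k), so it reduces to the cases
-- where the row or the column is 3. The row parity is only constrained where
-- it matters, namely on the diagonal (j = k) and just below it (j = k+1).
shiftC-descent : ∀ kOdd iOdd j k → (j ≡ k → iOdd ≡ kOdd) → (j ≡ suc k → iOdd ≡ not kOdd) →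
                 ShiftC kOdd iOdd (3 ℕ.+ j) (3 ℕ.+ k)
shiftC-descent kOdd iOdd (suc j) (suc k) diag below =
  shiftC-descent kOdd iOdd j k (diag ∘ cong suc) (below ∘ cong suc)
shiftC-descent true  true  zero zero _ _ = refl
shiftC-descent false false zero zero _ _ = refl
shiftC-descent true  false zero zero diag _ with () ← diag refl
shiftC-descent false true  zero zero diag _ with () ← diag refl
shiftC-descent true  true  zero (suc k) _ _ = refl
shiftC-descent true  false zero (suc k) _ _ = refl
shiftC-descent false true  zero (suc k) _ _ = refl
shiftC-descent false false zero (suc k) _ _ = refl
shiftC-descent true  false (suc zero) zero _ _ = refl
shiftC-descent false true  (suc zero) zero _ _ = refl
shiftC-descent true  true  (suc zero) zero _ below with () ← below refl
shiftC-descent false false (suc zero) zero _ below with () ← below refl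
shiftC-descent true  true  (suc (suc zero)) zero _ _ = refl
shiftC-descent true  false (suc (suc zero)) zero _ _ = refl
shiftC-descent false true  (suc (suc zero)) zero _ _ = refl
shiftC-descent false false (suc (suc zero)) zero _ _ = refl
shiftC-descent true  true  (suc (suc (suc j))) zero _ _ = refl
shiftC-descent true  false (suc (suc (suc j))) zero _ _ = refl
shiftC-descent false true  (suc (suc (suc j))) zero _ _ = refl
shiftC-descent false false (suc (suc (suc j))) zero _ _ = refl

shiftX-descent : ∀ kOdd iOdd j k → (j ≡ k → iOdd ≡ kOdd) → (j ≡ suc k → iOdd ≡ not kOdd) →
                 ShiftX kOdd iOdd (3 ℕ.+ j) (3 ℕ.+ k)
shiftX-descent kOdd iOdd (suc j) (suc k) diag below =
  shiftX-descent kOdd iOdd j k (diag ∘ cong suc) (below ∘ cong suc)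
shiftX-descent true  true  zero zero _ _ = refl
shiftX-descent false false zero zero _ _ = refl
shiftX-descent true  false zero zero diag _ with () ← diag refl
shiftX-descent false true  zero zero diag _ with () ← diag refl
shiftX-descent true  true  zero (suc k) _ _ = fib-signed (sign false) k
shiftX-descent true  false zero (suc k) _ _ = fib-signed (sign true) k
shiftX-descent false true  zero (suc k) _ _ = fib-signed (sign true) k
shiftX-descent false false zero (suc k) _ _ = fib-signed (sign false) k
shiftX-descent true  false (suc zero) zero _ _ = refl
shiftX-descent false true  (suc zero) zero _ _ = refl
shiftX-descent true  true  (suc zero) zero _ below with () ← below refl
shiftX-descent false false (suc zero) zero _ below with () ← below refl
shiftX-descent true  true  (suc (suc zero)) zero _ _ = refl
shiftX-descent true  false (suc (suc zero)) zero _ _ = refl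
shiftX-descent false true  (suc (suc zero)) zero _ _ = refl
shiftX-descent false false (suc (suc zero)) zero _ _ = refl
shiftX-descent true  true  (suc (suc (suc j))) zero _ _ = refl
shiftX-descent true  false (suc (suc (suc j))) zero _ _ = refl
shiftX-descent false true  (suc (suc (suc j))) zero _ _ = refl
shiftX-descent false false (suc (suc (suc j))) zero _ _ = refl

-- Rows 0, 1, 2 are computed directly (in X, row 1 holds ∓F_{K−2} and row 2
-- a signed F_{K−2}, so both follow the Fibonacci recurrence).
shiftC-top : ∀ kOdd k i → i < 3 → ShiftC kOdd (isOdd i) i (3 ℕ.+ k)
shiftC-top true  k 0 _ = refl
shiftC-top false k 0 _ = refl
shiftC-top true  k 1 _ = refl
shiftC-top false k 1 _ = refl
shiftC-top true  k 2 _ = refl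
shiftC-top false k 2 _ = refl
shiftC-top _ _ (suc (suc (suc _))) (s≤s (s≤s (s≤s ())))

shiftX-top : ∀ kOdd k i → i < 3 → ShiftX kOdd (isOdd i) i (3 ℕ.+ k)
shiftX-top true  k 0 _ = refl
shiftX-top false k 0 _ = refl
shiftX-top true  k 1 _ = fib-negative k
shiftX-top false k 1 _ = fib-positive k
shiftX-top true  k 2 _ = fib-signed (sign true) k
shiftX-top false k 2 _ = fib-signed (sign false) k
shiftX-top _ _ (suc (suc (suc _))) (s≤s (s≤s (s≤s ())))

shiftC : ∀ k i → ShiftC (isOdd (3 ℕ.+ k)) (isOdd i) i (3 ℕ.+ k)
shiftC k 0 = shiftC-top _ k 0 z<s
shiftC k 1 = shiftC-top _ k 1 (s<s z<s)
shiftC k 2 = shiftC-top _ k 2 (s<s (s<s z<s))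
shiftC k (suc (suc (suc j))) =
  shiftC-descent _ _ j k (cong (isOdd ∘ (3 ℕ.+_))) (λ { refl → refl })

shiftX : ∀ k i → ShiftX (isOdd (3 ℕ.+ k)) (isOdd i) i (3 ℕ.+ k)
shiftX k 0 = shiftX-top _ k 0 z<s
shiftX k 1 = shiftX-top _ k 1 (s<s z<s)
shiftX k 2 = shiftX-top _ k 2 (s<s (s<s z<s))
shiftX k (suc (suc (suc j))) =
  shiftX-descent _ _ j k (cong (isOdd ∘ (3 ℕ.+_))) (λ { refl → refl })

move-diagonal : ∀ (w : ℤ) {i L} → i < L → w ≡ w - δ i L + δ i (suc L)
move-diagonal w {i} {L} i<L = sym (begin
  w - δ i L + δ i (suc L)  ≡⟨ cong₂ (λ d d′ → w - d + d′) (δ-< i<L) (δ-< (m<n⇒m<1+n i<L)) ⟩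
  w - + 0 + + 0            ≡⟨ ring w ⟩
  w                        ∎)
  where
  ring : ∀ w → w - + 0 + + 0 ≡ w
  ring = solve-∀

diagonal-only : ∀ d d′ → d′ ≡ d - d + d′
diagonal-only = solve-∀

-- The last two columns of C₁ share the off-diagonal rows `above`, and
-- likewise for X (rows with value u or v); only the diagonal 1 moves.
last-column-C : ∀ (above : Bool) i L → (T above → i < L) →
  bool→ℤ (above ∨ (i ≡ᵇ suc L)) ≡ bool→ℤ (above ∨ (i ≡ᵇ L)) - δ i L + δ i (suc L)
last-column-C true  i L i<L = move-diagonal (+ 1) (i<L tt)
last-column-C false i L _   = diagonal-only (δ i L) (δ i (suc L))

last-column-X : ∀ (above₁ above₂ : Bool) (u v : ℤ) i L → (T above₁ → i < L) → (T above₂ → i < L) →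
  (if above₁ then u else if above₂ then v else δ i (suc L))
    ≡ (if above₁ then u else if above₂ then v else δ i L) - δ i L + δ i (suc L)
last-column-X true  _     u _ i L i<L _ = move-diagonal u (i<L tt)
last-column-X false true  _ v i L _ i<L = move-diagonal v (i<L tt)
last-column-X false false _ _ i L _ _   = diagonal-only (δ i L) (δ i (suc L))

isOdd-double : ∀ q → isOdd (q ℕ.* 2) ≡ false
isOdd-double zero    = refl
isOdd-double (suc q) = cong (not ∘ not) (isOdd-double q)

even⇒not-odd : ∀ {k} → 2 ∣ k → isOdd k ≡ false
even⇒not-odd (divides q refl) = isOdd-double q

module Columns (L : ℕ) (L-even : 2 ∣ L) where

  n m : ℕ
  n = 6 ℕ.+ L
  m = 5 ℕ.+ L

  open Propagation m (C1-entry n) (X-entry n)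
    renaming (a to c; b to x)
  module Dual = Propagation m (X-entry n) (C1-entry n)

  generic : ∀ {k} → k < 2 ℕ.+ L → (3 ℕ.+ k ≡ᵇ n ∸ 1) ≡ false
  generic = <⇒≡ᵇ-false

  -- column 3 and the step from column 2 to column 4, checked row by row
  -- (rows below the column are 0; C₁ tests the parity of the row)
  c₃ : ∀ i → c 3 i ≡ δ i 1 + δ i 2 + δ i 3
  c₃ 0 = refl
  c₃ 1 = refl
  c₃ 2 = refl
  c₃ 3 = refl
  c₃ (suc (suc (suc (suc j)))) with isOdd j
  ... | true  = refl
  ... | false = refl

  x₃ : ∀ i → x 3 i ≡ δ i 3 - δ i 1 - δ i 2
  x₃ 0 = refl
  x₃ 1 = refl
  x₃ 2 = refl
  x₃ 3 = refl
  x₃ (suc (suc (suc (suc j)))) = refl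

  shiftA₂ : ShiftA 2
  shiftA₂ 0 = refl
  shiftA₂ 1 = refl
  shiftA₂ 2 = refl
  shiftA₂ 3 = refl
  shiftA₂ 4 = refl
  shiftA₂ (suc (suc (suc (suc (suc j))))) with isOdd j
  ... | true  = refl
  ... | false = refl

  shiftB₂ : ShiftB 2
  shiftB₂ 0 = refl
  shiftB₂ 1 = refl
  shiftB₂ 2 = refl
  shiftB₂ 3 = refl
  shiftB₂ 4 = refl
  shiftB₂ (suc (suc (suc (suc (suc j))))) = refl

  shifts : ∀ k → k ≤ L → ShiftA (2 ℕ.+ k) × ShiftB (2 ℕ.+ k)
  shifts zero    _   = shiftA₂ , shiftB₂
  shifts (suc k) k<L = shiftA , shiftB
    where
    k<L+2 : k < 2 ℕ.+ L
    k<L+2 = m<n⇒m<1+n (m<n⇒m<1+n k<L)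

    shiftA : ShiftA (3 ℕ.+ k)
    shiftA i = begin
      c (5 ℕ.+ k) i
        ≡⟨ C-generic n i (2 ℕ.+ k) (generic (s<s (s<s k<L))) ⟩
      colC (isOdd (5 ℕ.+ k)) (isOdd i) i (5 ℕ.+ k)
        ≡⟨ shiftC k i ⟩
      colC (isOdd (3 ℕ.+ k)) (isOdd i) i (3 ℕ.+ k) + δ i (4 ℕ.+ k) + δ i (5 ℕ.+ k) - δ i (3 ℕ.+ k)
        ≡⟨ cong (λ t → t + δ i (4 ℕ.+ k) + δ i (5 ℕ.+ k) - δ i (3 ℕ.+ k)) (sym (C-generic n i k (generic k<L+2))) ⟩
      c (3 ℕ.+ k) i + δ i (4 ℕ.+ k) + δ i (5 ℕ.+ k) - δ i (3 ℕ.+ k) ∎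

    shiftB : ShiftB (3 ℕ.+ k)
    shiftB i = begin
      x (5 ℕ.+ k) i
        ≡⟨ X-generic n i (2 ℕ.+ k) (generic (s<s (s<s k<L))) ⟩
      colX (isOdd (5 ℕ.+ k)) (isOdd i) i (5 ℕ.+ k)
        ≡⟨ shiftX k i ⟩
      δ i (5 ℕ.+ k) - δ i (3 ℕ.+ k) + colX (isOdd (3 ℕ.+ k)) (isOdd i) i (3 ℕ.+ k) - colX (isOdd (4 ℕ.+ k)) (isOdd i) i (4 ℕ.+ k)
        ≡⟨ cong₂ (λ s t → δ i (5 ℕ.+ k) - δ i (3 ℕ.+ k) + s - t)
                 (sym (X-generic n i k (generic k<L+2)))
                 (sym (X-generic n i (suc k) (generic (s<s (m<n⇒m<1+n k<L))))) ⟩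
      δ i (5 ℕ.+ k) - δ i (3 ℕ.+ k) + x (3 ℕ.+ k) i - x (4 ℕ.+ k) i ∎

  even₄ : isOdd (4 ℕ.+ L) ≡ false
  even₄ = even⇒not-odd (∣m∣n⇒∣m+n (divides 2 refl) L-even)

  generic₄ : (4 ℕ.+ L ≡ᵇ n ∸ 1) ≡ false
  generic₄ = generic (n<1+n (suc L))

  aboveC aboveX : ℕ → Bool
  aboveC i = isOdd i ∧ (3 ≤ᵇ' i) ∧ (i ≤ᵇ' (3 ℕ.+ L))
  aboveX i = (2 ≤ᵇ' i) ∧ (i ≤ᵇ' (3 ℕ.+ L))

  aboveX-< : ∀ i → T (aboveX i) → i < 4 ℕ.+ L
  aboveX-< i t = <ᵇ⇒< i (4 ℕ.+ L) (proj₂ (Equivalence.to (T-∧ {2 ≤ᵇ' i}) t))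

  aboveC-< : ∀ i → T (aboveC i) → i < 4 ℕ.+ L
  aboveC-< i t = <ᵇ⇒< i (4 ℕ.+ L) (proj₂ (Equivalence.to (T-∧ {3 ≤ᵇ' i}) (proj₂ (Equivalence.to (T-∧ {isOdd i}) t))))

  row₁-< : ∀ i → T (i ≡ᵇ 1) → i < 4 ℕ.+ L
  row₁-< i t with ≡ᵇ⇒≡ i 1 t
  ... | refl = s<s z<s

  c-last : ∀ i → c (5 ℕ.+ L) i ≡ bool→ℤ (aboveC i ∨ (i ≡ᵇ 5 ℕ.+ L))
  c-last i rewrite ≡ᵇ-refl L = refl

  c-penultimate : ∀ i → c (4 ℕ.+ L) i ≡ bool→ℤ (aboveC i ∨ (i ≡ᵇ 4 ℕ.+ L))
  c-penultimate i = trans (C-generic n i (suc L) generic₄) (cong (λ p → colC p (isOdd i) i (4 ℕ.+ L)) even₄)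

  x-last : ∀ i → x (5 ℕ.+ L) i
           ≡ (if i ≡ᵇ 1 then + F (2 ℕ.+ L) else if aboveX i then sgn i * + F (4 ℕ.+ L ∸ i) else δ i (5 ℕ.+ L))
  x-last i rewrite ≡ᵇ-refl L = refl

  x-penultimate : ∀ i → x (4 ℕ.+ L) i
           ≡ (if i ≡ᵇ 1 then + F (2 ℕ.+ L) else if aboveX i then sgn i * + F (4 ℕ.+ L ∸ i) else δ i (4 ℕ.+ L))
  x-penultimate i = trans (X-generic n i (suc L) generic₄) (cong (λ p → colX p (isOdd i) i (4 ℕ.+ L)) even₄)

  lastA : LastA (4 ℕ.+ L)
  lastA i = begin
    c (5 ℕ.+ L) i
      ≡⟨ c-last i ⟩
    bool→ℤ (aboveC i ∨ (i ≡ᵇ 5 ℕ.+ L))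
      ≡⟨ last-column-C (aboveC i) i (4 ℕ.+ L) (aboveC-< i) ⟩
    bool→ℤ (aboveC i ∨ (i ≡ᵇ 4 ℕ.+ L)) - δ i (4 ℕ.+ L) + δ i (5 ℕ.+ L)
      ≡⟨ cong (λ t → t - δ i (4 ℕ.+ L) + δ i (5 ℕ.+ L)) (sym (c-penultimate i)) ⟩
    c (4 ℕ.+ L) i - δ i (4 ℕ.+ L) + δ i (5 ℕ.+ L) ∎

  lastB : LastB (4 ℕ.+ L)
  lastB i = begin
    x (5 ℕ.+ L) i
      ≡⟨ x-last i ⟩
    _ ≡⟨ last-column-X (i ≡ᵇ 1) (aboveX i) _ _ i (4 ℕ.+ L) (row₁-< i) (aboveX-< i) ⟩
    _ ≡⟨ cong (λ t → t - δ i (4 ℕ.+ L) + δ i (5 ℕ.+ L)) (sym (x-penultimate i)) ⟩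
    x (4 ℕ.+ L) i - δ i (4 ℕ.+ L) + δ i (5 ℕ.+ L) ∎

  ab₃ : AB 3
  ab₃ i = begin
    act m (C1-entry n) (x 3) i             ≡⟨ act-cong x₃ ⟩
    act m (C1-entry n) (e 3 ⊖ e 1 ⊖ e 2) i ≡⟨ act-unit 2 (s<s (s<s z<s)) ⊖ᵖ act-unit 0 z<s ⊖ᵖ act-unit 1 (s<s z<s) ⟩
    c 3 i - δ i 1 - δ i 2                  ≡⟨ cong (λ t → t - δ i 1 - δ i 2) (c₃ i) ⟩
    δ i 1 + δ i 2 + δ i 3 - δ i 1 - δ i 2  ≡⟨ ring (δ i 1) (δ i 2) (δ i 3) ⟩
    δ i 3                                  ∎
    where
    ring : ∀ d₁ d₂ d₃ → d₁ + d₂ + d₃ - d₁ - d₂ ≡ d₃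
    ring = solve-∀

  ba₃ : BA 3
  ba₃ i = begin
    act m (X-entry n) (c 3) i              ≡⟨ act-cong c₃ ⟩
    act m (X-entry n) (e 1 ⊕ e 2 ⊕ e 3) i  ≡⟨ act-unit 0 z<s ⊕ᵖ act-unit 1 (s<s z<s) ⊕ᵖ act-unit 2 (s<s (s<s z<s)) ⟩
    δ i 1 + δ i 2 + x 3 i                  ≡⟨ cong (λ t → δ i 1 + δ i 2 + t) (x₃ i) ⟩
    δ i 1 + δ i 2 + (δ i 3 - δ i 1 - δ i 2) ≡⟨ ring (δ i 1) (δ i 2) (δ i 3) ⟩
    δ i 3                                  ∎
    where
    ring : ∀ d₁ d₂ d₃ → d₁ + d₂ + (d₃ - d₁ - d₂) ≡ d₃
    ring = solve-∀

  ab : ∀ k → k ≤ 3 ℕ.+ L → AB (suc k)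
  ab 0 _ i = act-unit 0 z<s
  ab 1 _ i = act-unit 1 (s<s z<s)
  ab 2 _   = ab₃
  ab (suc (suc (suc k))) (s≤s (s≤s (s≤s k≤L))) =
    AB-shift (suc k) (m≤n⇒m≤1+n (s≤s (s≤s (s≤s (s≤s k≤L)))))
             (proj₁ (shifts k k≤L)) (proj₂ (shifts k k≤L))
             (ab (suc k) (s≤s (m≤n⇒m≤1+n (m≤n⇒m≤1+n k≤L))))
             (ab (suc (suc k)) (s≤s (s≤s (m≤n⇒m≤1+n k≤L))))

  ba : ∀ k → k ≤ 3 ℕ.+ L → BA (suc k)
  ba 0 _ i = act-unit 0 z<s
  ba 1 _ i = act-unit 1 (s<s z<s)
  ba 2 _   = ba₃
  ba (suc (suc (suc k))) (s≤s (s≤s (s≤s k≤L))) =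
    BA-shift (suc k) (m≤n⇒m≤1+n (s≤s (s≤s (s≤s (s≤s k≤L)))))
             (proj₁ (shifts k k≤L)) (proj₂ (shifts k k≤L))
             (ba (suc k) (s≤s (m≤n⇒m≤1+n (m≤n⇒m≤1+n k≤L))))

  ab-all : ∀ k → k < m → AB (suc k)
  ab-all k k<m with m≤n⇒m<n∨m≡n k<m
  ... | inj₁ k+1<m = ab k (≤-pred (≤-pred k+1<m))
  ... | inj₂ refl  = AB-last (3 ℕ.+ L) ≤-refl lastA lastB (ab (3 ℕ.+ L) ≤-refl)

  ba-all : ∀ k → k < m → BA (suc k)
  ba-all k k<m with m≤n⇒m<n∨m≡n k<m
  ... | inj₁ k+1<m = ba k (≤-pred (≤-pred k+1<m))
  ... | inj₂ refl  = Dual.AB-last (3 ℕ.+ L) ≤-refl lastB lastA (ba (3 ℕ.+ L) ≤-refl)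

  inverse : IsInverseOf (X n) (C₁ n)
  inverse = product-identity ab-all , Dual.product-identity ba-all

lemma2p1 : (n : ℕ) → 6 ≤ n → 2 ∣ n → IsInverseOf (X n) (C₁ n)
lemma2p1 _ (s≤s (s≤s (s≤s (s≤s (s≤s (s≤s {n = L} z≤n)))))) 2∣n =
  Columns.inverse L (∣m+n∣m⇒∣n 2∣n (divides 3 refl))
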